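{- The map $X\mapsto\mathcal{R}(X)$ induces an embedding of the Turing degrees into the generic degrees: for all reals $X,Y$, $Y\geq_T X$ if and only if $\mathcal{R}(Y)\geq_g\mathcal{R}(X)$.
   Context: Reals are subsets of $\mathbb{N}$; $n=\{0,\dots,n-1\}$; a real $A$ is density-1 if $\lim_{n\to\infty}|A\cap n|/n=1$. For a real $X$, $\mathcal{R}(X)=\{2^m k: m\in X,\ k\in\mathbb{N},\ k\text{ odd}\}$. A partial oracle for a real $C$ is a set $(C)$ of triples $\langle n,x,l\rangle$ (coded as naturals, usable as a Turing oracle) such that $\langle n,0,l\rangle\in(C)$ implies $n\notin C$ and $\langle n,1,l\rangle\in(C)$ implies $n\in C$; $\mathrm{dom}((C))=\{n:\exists x,l\ \langle n,x,l\rangle\in(C)\}$. A generic oracle for $C$ is a partial oracle for $C$ with density-1 domain. $\varphi^X$ is a generic computation of $D$ if $\mathrm{dom}(\varphi^X)$ is density-1, $\varphi^X$ has values in $\{0,1\}$, and agrees with $D$ on its domain. $C\geq_g D$ if there is a single Turing functional $\varphi$ such that for every generic oracle $(C)$ for $C$, $\varphi^{(C)}$ is a generic computation of $D$; generic degrees are equivalence classes under mutual $\geq_g$. -}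

module Defs where

open import Data.Nat using (ℕ; zero; suc; _+_; _*_; _∸_; _^_; _≤_; _<_)
open import Data.Bool using (Bool; true; false)
open import Data.Fin using (Fin)
open import Data.Vec using (Vec; []; _∷_; lookup)
open import Data.List using (List; length)
open import Data.List.Relation.Unary.All using (All)
open import Data.List.Relation.Unary.Unique.Propositional using (Unique)
open import Data.Product using (Σ; ∃; ∃-syntax; _×_; _,_)
open import Data.Sum using (_⊎_)
open import Relation.Binary.PropositionalEquality using (_≡_)
open import Relation.Nullary using (¬_)

-- Reals are subsets of ℕ, given by characteristic functions ℕ → Bool.
-- (Sets which only appear as predicates are ℕ → Set.)

Real : Set
Real = ℕ → Bool

bit : Bool → ℕ
bit true  = 1
bit false = 0

-- Oracle computations: partial recursive functions relative to an
-- oracle X (μ-recursive functions with the characteristic function of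
-- X as an extra basic function).  A Turing functional is a code.

data Code : ℕ → Set where
  zer  : ∀ {k} → Code k
  succ : Code 1
  proj : ∀ {k} → Fin k → Code k
  orc  : Code 1
  comp : ∀ {k m} → Code m → Vec (Code k) m → Code k
  prec : ∀ {k} → Code k → Code (suc (suc k)) → Code (suc k)
  mu   : ∀ {k} → Code (suc k) → Code k

mutual
  data Eval (X : ℕ → Bool) : ∀ {k} → Code k → Vec ℕ k → ℕ → Set where
    ezer  : ∀ {k} {xs : Vec ℕ k} → Eval X zer xs 0
    esucc : ∀ {n} → Eval X succ (n ∷ []) (suc n)
    eproj : ∀ {k} {xs : Vec ℕ k} (i : Fin k) → Eval X (proj i) xs (lookup xs i)
    eorc  : ∀ {n} → Eval X orc (n ∷ []) (bit (X n))
    ecomp : ∀ {k m} {f : Code m} {gs : Vec (Code k) m} {xs : Vec ℕ k}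
              {ys : Vec ℕ m} {v : ℕ} →
            EvalV X gs xs ys → Eval X f ys v → Eval X (comp f gs) xs v
    eprec0 : ∀ {k} {f : Code k} {g : Code (suc (suc k))} {xs : Vec ℕ k} {v} →
             Eval X f xs v → Eval X (prec f g) (0 ∷ xs) v
    eprecS : ∀ {k} {f : Code k} {g : Code (suc (suc k))} {xs : Vec ℕ k}
               {n w v} →
             Eval X (prec f g) (n ∷ xs) w → Eval X g (n ∷ w ∷ xs) v →
             Eval X (prec f g) (suc n ∷ xs) v
    emu   : ∀ {k} {f : Code (suc k)} {xs : Vec ℕ k} {n : ℕ} →
            Eval X f (n ∷ xs) 0 →
            (∀ i → i < n → Σ ℕ (λ w → Eval X f (i ∷ xs) (suc w))) →
            Eval X (mu f) xs n

  data EvalV (X : ℕ → Bool) {k : ℕ} : ∀ {m} → Vec (Code k) m → Vec ℕ k → Vec ℕ m → Set where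
    [] : ∀ {xs} → EvalV X [] xs []
    _∷_ : ∀ {m} {g : Code k} {gs : Vec (Code k) m} {xs} {y} {ys : Vec ℕ m} →
          Eval X g xs y → EvalV X gs xs ys → EvalV X (g ∷ gs) xs (y ∷ ys)

_≥T_ : Real → Real → Set
Y ≥T X = Σ (Code 1) λ e → ∀ n → Eval Y e (n ∷ []) (bit (X n))

-- Density.  |A ∩ n| ≥ c is witnessed by a duplicate-free list of c
-- elements of A below n (A need not be decidable).

AtLeast : (ℕ → Set) → ℕ → ℕ → Set
AtLeast A n c = Σ (List ℕ) λ L → Unique L × All (λ x → x < n × A x) L × c ≤ length L

-- lim |A ∩ n|/n = 1 : for every k, eventually the proportion of
-- n \ A among {0..n-1} is at most 1/(k+1).
Density1 : (ℕ → Set) → Set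
Density1 A = ∀ k → ∃[ N ] ∀ n → N ≤ n →
             ∃[ c ] (AtLeast A n c × suc k * (n ∸ c) ≤ n)

R : Real → (ℕ → Set)
R X m = ∃[ a ] ∃[ j ] (X a ≡ true × m ≡ 2 ^ a * (2 * j + 1))

-- Coding of triples: pair a b = 2^a (2b+1) - 1 (a bijection ℕ² → ℕ).

pair : ℕ → ℕ → ℕ
pair a b = 2 ^ a * (2 * b + 1) ∸ 1

triple : ℕ → ℕ → ℕ → ℕ
triple n x l = pair n (pair x l)

PartialOracle : (ℕ → Set) → Real → Set
PartialOracle C O =
  (∀ m → O m ≡ true → ∃[ n ] ∃[ x ] ∃[ l ] (m ≡ triple n x l × x ≤ 1)) ×
  (∀ n l → O (triple n 0 l) ≡ true → ¬ C n) ×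
  (∀ n l → O (triple n 1 l) ≡ true → C n)

dom : Real → (ℕ → Set)
dom O n = ∃[ x ] ∃[ l ] (O (triple n x l) ≡ true)

GenericOracle : (ℕ → Set) → Real → Set
GenericOracle C O = PartialOracle C O × Density1 (dom O)

GenericComputation : Code 1 → Real → (ℕ → Set) → Set
GenericComputation e O D =
  Density1 (λ n → ∃[ v ] Eval O e (n ∷ []) v) ×
  (∀ n v → Eval O e (n ∷ []) v → (v ≡ 0 × ¬ D n) ⊎ (v ≡ 1 × D n))

_≥g_ : (ℕ → Set) → (ℕ → Set) → Set
C ≥g D = Σ (Code 1) λ e → ∀ O → GenericOracle C O → GenericComputation e O D

module Submission where

-- Column a = {2^a (2j+1) : j ∈ ℕ} has density 2^-(a+1) > 0, so every density-1
-- set meets every column (meets-every-column); on column a, R(X) is constantly X(a).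
--
-- (⇒) From a generic oracle O for R(Y), compute Y(b) by searching for a triple
--     ⟨n,x,l⟩ ∈ O with n in column b (one exists, as dom O has density 1) and
--     reading off x.  Relativizing X ≤T Y to this search gives a total, hence
--     generic, O-computation of R(X).
-- (⇐) The total oracle {⟨n, R(Y)(n), l⟩} is computable from Y and generic for R(Y).
--     The generic reduction converges somewhere in column a; a dovetailed search
--     over (point, step budget), run by a step-counting interpreter, finds such
--     a point, and its output is X(a).

open import Defs
open import Data.Nat using (ℕ; zero; suc; _+_; _*_; _∸_; _^_; _≤_; _<_; pred; z≤n; s≤s; z<s; NonZero; _≡ᵇ_)
open import Data.Nat.Properties
open import Data.Nat.DivMod
  using (_%_; _/_; m≡m%n+[m/n]*n; [m+kn]%n≡m%n; m<n⇒m%n≡m; n%n≡0; m%n<n; m*n%n≡0)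
open import Data.Nat.Divisibility using (_∣_; divides; m%n≡0⇒n∣m; n∣m⇒m%n≡0)
open import Data.Nat.Solver using (module +-*-Solver)
open import Data.Bool using (true; false; T)
open import Data.Fin using (Fin; zero; suc; _↑ʳ_)
open import Data.Vec using (Vec; []; _∷_; _++_; lookup; tabulate)
open import Data.Vec.Properties using (tabulate∘lookup; tabulate-cong; lookup-++ʳ)
open import Data.List using (List; []; _∷_; length; map; upTo)
import Data.List as List
open import Data.List.Properties using (length-++; length-map; length-upTo)
open import Data.List.Membership.Propositional using (_∈_; _∉_)
open import Data.List.Membership.Propositional.Properties using (∈-∃++; ∈-map⁻; ∈-upTo⁺; ∈-upTo⁻)
open import Data.List.Membership.DecPropositional _≟_ using (_∈?_)
open import Data.List.Relation.Unary.Any using (here; there)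
open import Data.List.Relation.Unary.All as All using (All; []; _∷_)
import Data.List.Relation.Unary.All.Properties as All
open import Data.List.Relation.Unary.Unique.Propositional using (Unique)
import Data.List.Relation.Unary.Unique.Propositional.Properties as Unique
open import Data.List.Relation.Unary.AllPairs using ([]; _∷_)
open import Data.List.Relation.Binary.Disjoint.Propositional using (Disjoint)
open import Data.Product using (Σ; ∃-syntax; _×_; _,_; proj₁; proj₂)
open import Data.Sum using (_⊎_; inj₁; inj₂)
open import Data.Empty using (⊥-elim)
open import Data.Unit using (⊤; tt)
open import Relation.Binary.PropositionalEquality
open import Relation.Nullary using (¬_; yes; no)
open import Relation.Binary.Definitions using (tri<; tri≈; tri>)
open import Function.Bundles using (_⇔_; mk⇔)
open +-*-Solver using (solve; _:*_; _:+_; con; _:=_)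

-- The machine model: determinism and relativization

-- A computation has at most one output (for μ: the least zero is unique).
mutual
  eval-deterministic : ∀ {X k} {c : Code k} {xs v w} → Eval X c xs v → Eval X c xs w → v ≡ w
  eval-deterministic ezer ezer = refl
  eval-deterministic esucc esucc = refl
  eval-deterministic (eproj i) (eproj .i) = refl
  eval-deterministic eorc eorc = refl
  eval-deterministic (ecomp ds d) (ecomp ds′ d′) with evals-deterministic ds ds′
  ... | refl = eval-deterministic d d′
  eval-deterministic (eprec0 d) (eprec0 d′) = eval-deterministic d d′
  eval-deterministic (eprecS d e) (eprecS d′ e′) with eval-deterministic d d′
  ... | refl = eval-deterministic e e′
  eval-deterministic (emu {n = n} d below) (emu {n = n′} d′ below′) with <-cmp n n′
  ... | tri≈ _ n≡n′ _ = n≡n′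
  ... | tri< n<n′ _ _ with below′ n n<n′
  ...   | _ , d″ with eval-deterministic d d″
  ...     | ()
  eval-deterministic (emu {n = n} d below) (emu {n = n′} d′ below′) | tri> _ _ n′<n
    with below n′ n′<n
  ... | _ , d″ with eval-deterministic d′ d″
  ...   | ()

  evals-deterministic : ∀ {X k m} {gs : Vec (Code k) m} {xs ys ys′} →
                        EvalV X gs xs ys → EvalV X gs xs ys′ → ys ≡ ys′
  evals-deterministic [] [] = refl
  evals-deterministic (d ∷ ds) (d′ ∷ ds′) =
    cong₂ _∷_ (eval-deterministic d d′) (evals-deterministic ds ds′)

mutual
  relativize : ∀ {k} → Code k → Code 1 → Code k
  relativize zer q = zer
  relativize succ q = succ
  relativize (proj i) q = proj i
  relativize orc q = q
  relativize (comp f gs) q = comp (relativize f q) (relativizeV gs q)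
  relativize (prec f g) q = prec (relativize f q) (relativize g q)
  relativize (mu f) q = mu (relativize f q)

  relativizeV : ∀ {k m} → Vec (Code k) m → Code 1 → Vec (Code k) m
  relativizeV [] q = []
  relativizeV (g ∷ gs) q = relativize g q ∷ relativizeV gs q

-- If q computes Y with oracle O, then c with oracle Y and (relativize c q)
-- with oracle O have exactly the same computations.  This is transitivity of
-- Turing reducibility, and is used in both directions of the theorem.
module Relativization {Y O : Real} {q : Code 1}
                      (q-computes : ∀ n → Eval O q (n ∷ []) (bit (Y n))) where

  mutual
    relativize⁺ : ∀ {k} {c : Code k} {xs v} → Eval Y c xs v → Eval O (relativize c q) xs v
    relativize⁺ ezer = ezer
    relativize⁺ esucc = esucc
    relativize⁺ (eproj i) = eproj i
    relativize⁺ (eorc {n}) = q-computes n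
    relativize⁺ (ecomp ds d) = ecomp (relativizeV⁺ ds) (relativize⁺ d)
    relativize⁺ (eprec0 d) = eprec0 (relativize⁺ d)
    relativize⁺ (eprecS d e) = eprecS (relativize⁺ d) (relativize⁺ e)
    relativize⁺ (emu d below) =
      emu (relativize⁺ d) (λ i i<n → proj₁ (below i i<n) , relativize⁺ (proj₂ (below i i<n)))

    relativizeV⁺ : ∀ {k m} {gs : Vec (Code k) m} {xs ys} →
                   EvalV Y gs xs ys → EvalV O (relativizeV gs q) xs ys
    relativizeV⁺ [] = []
    relativizeV⁺ (d ∷ ds) = relativize⁺ d ∷ relativizeV⁺ ds

  mutual
    relativize⁻ : ∀ {k} (c : Code k) {xs v} → Eval O (relativize c q) xs v → Eval Y c xs v
    relativize⁻ zer ezer = ezer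
    relativize⁻ succ esucc = esucc
    relativize⁻ (proj i) (eproj .i) = eproj i
    relativize⁻ orc {n ∷ []} d with eval-deterministic d (q-computes n)
    ... | refl = eorc
    relativize⁻ (comp f gs) (ecomp ds d) = ecomp (relativizeV⁻ gs ds) (relativize⁻ f d)
    relativize⁻ (prec f g) (eprec0 d) = eprec0 (relativize⁻ f d)
    relativize⁻ (prec f g) (eprecS d e) = eprecS (relativize⁻ (prec f g) d) (relativize⁻ g e)
    relativize⁻ (mu f) (emu d below) =
      emu (relativize⁻ f d) (λ i i<n → proj₁ (below i i<n) , relativize⁻ f (proj₂ (below i i<n)))

    relativizeV⁻ : ∀ {k m} (gs : Vec (Code k) m) {xs ys} →
                   EvalV O (relativizeV gs q) xs ys → EvalV Y gs xs ys
    relativizeV⁻ [] [] = []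
    relativizeV⁻ (g ∷ gs) (d ∷ ds) = relativize⁻ g d ∷ relativizeV⁻ gs ds

Computes : Real → ∀ {k} → Code k → (Vec ℕ k → ℕ) → Set
Computes X c f = ∀ xs → Eval X c xs (f xs)

ComputesV : Real → ∀ {k m} → Vec (Code k) m → (Vec ℕ k → Vec ℕ m) → Set
ComputesV X gs f = ∀ xs → EvalV X gs xs (f xs)

computes-ext : ∀ {X k} {c : Code k} {f g} → (∀ xs → f xs ≡ g xs) → Computes X c f → Computes X c g
computes-ext f≗g c-computes xs = subst (Eval _ _ xs) (f≗g xs) (c-computes xs)

unary : (ℕ → ℕ) → Vec ℕ 1 → ℕ
unary f (n ∷ []) = f n

binary : (ℕ → ℕ → ℕ) → Vec ℕ 2 → ℕ
binary f (m ∷ n ∷ []) = f m n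

primRec : ∀ {k} → (Vec ℕ k → ℕ) → (Vec ℕ (suc (suc k)) → ℕ) → Vec ℕ (suc k) → ℕ
primRec f g (zero ∷ xs) = f xs
primRec f g (suc n ∷ xs) = g (n ∷ primRec f g (n ∷ xs) ∷ xs)

prec-computes : ∀ {X k} {f : Code k} {g} {F G} → Computes X f F → Computes X g G →
                Computes X (prec f g) (primRec F G)
prec-computes f-computes g-computes (zero ∷ xs) = eprec0 (f-computes xs)
prec-computes f-computes g-computes (suc n ∷ xs) =
  eprecS (prec-computes f-computes g-computes (n ∷ xs)) (g-computes _)

-- Signum and zero test, used to express case distinctions arithmetically.
sgn : ℕ → ℕ
sgn zero = 0
sgn (suc _) = 1

isz : ℕ → ℕ
isz zero = 1
isz (suc _) = 0

isz-nonzero : ∀ {n} → n ≢ 0 → isz n ≡ 0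
isz-nonzero {zero} n≢0 = ⊥-elim (n≢0 refl)
isz-nonzero {suc n} _ = refl

sgn-positive : ∀ {n} → 0 < n → sgn n ≡ 1
sgn-positive {suc n} _ = refl

constCode : ∀ {k} → ℕ → Code k
constCode zero = zer
constCode (suc n) = comp succ (constCode n ∷ [])

constCode-computes : ∀ {X k} n (xs : Vec ℕ k) → Eval X (constCode n) xs n
constCode-computes zero xs = ezer
constCode-computes (suc n) xs = ecomp (constCode-computes n xs ∷ []) esucc

predCode sgCode iszCode : Code 1
predCode = prec zer (proj zero)
sgCode = prec zer (constCode 1)
iszCode = prec (constCode 1) zer

predCode-computes : ∀ {X} n → Eval X predCode (n ∷ []) (pred n)
predCode-computes zero = eprec0 ezer
predCode-computes (suc n) = eprecS (predCode-computes n) (eproj zero)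

sgCode-computes : ∀ {X} n → Eval X sgCode (n ∷ []) (sgn n)
sgCode-computes zero = eprec0 ezer
sgCode-computes (suc n) = eprecS (sgCode-computes n) (constCode-computes 1 _)

iszCode-computes : ∀ {X} n → Eval X iszCode (n ∷ []) (isz n)
iszCode-computes zero = eprec0 (constCode-computes 1 _)
iszCode-computes (suc n) = eprecS (iszCode-computes n) ezer

addCode mulCode monusCode : Code 2
addCode = prec (proj zero) (comp succ (proj (suc zero) ∷ []))
mulCode = prec zer (comp addCode (proj (suc (suc zero)) ∷ proj (suc zero) ∷ []))
-- x ∸ y by recursion on y: decrement x, y times.
monusCode = comp (prec (proj zero) (comp predCode (proj (suc zero) ∷ [])))
                 (proj (suc zero) ∷ proj zero ∷ [])

addCode-computes : ∀ {X} x y → Eval X addCode (x ∷ y ∷ []) (x + y)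
addCode-computes zero y = eprec0 (eproj zero)
addCode-computes (suc x) y =
  eprecS (addCode-computes x y) (ecomp (eproj (suc zero) ∷ []) esucc)

mulCode-computes : ∀ {X} x y → Eval X mulCode (x ∷ y ∷ []) (x * y)
mulCode-computes zero y = eprec0 ezer
mulCode-computes (suc x) y =
  eprecS (mulCode-computes x y) (ecomp (eproj _ ∷ eproj _ ∷ []) (addCode-computes y (x * y)))

monusCode-computes : ∀ {X} x y → Eval X monusCode (x ∷ y ∷ []) (x ∸ y)
monusCode-computes x y = ecomp (eproj _ ∷ eproj _ ∷ []) (decrement y)
  where
  decrement : ∀ {X} y → Eval X (prec (proj zero) (comp predCode (proj (suc zero) ∷ [])))
                                (y ∷ x ∷ []) (x ∸ y)
  decrement zero = eprec0 (eproj zero)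
  decrement (suc y) = subst (Eval _ _ (suc y ∷ x ∷ [])) (pred[m∸n]≡m∸[1+n] x y)
    (eprecS (decrement y) (ecomp (eproj _ ∷ []) (predCode-computes (x ∸ y))))

-- Arithmetic expressions in k variables, compiled to codes.  `call c f es`
-- applies a code c that is meant to compute f; that it does is a proof
-- obligation collected by WellCalled.
infixl 6 _⊕_ _⊖_
infixl 7 _⊗_
data Expr (k : ℕ) : Set where
  var : Fin k → Expr k
  lit : ℕ → Expr k
  _⊕_ _⊗_ _⊖_ : Expr k → Expr k → Expr k
  sg isZero dec query : Expr k → Expr k
  call : ∀ {m} → Code m → (Vec ℕ m → ℕ) → Vec (Expr k) m → Expr k

mutual
  ⟦_⟧ : ∀ {k} → Expr k → Real → Vec ℕ k → ℕ
  ⟦ var i ⟧ X xs = lookup xs i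
  ⟦ lit n ⟧ X xs = n
  ⟦ a ⊕ b ⟧ X xs = ⟦ a ⟧ X xs + ⟦ b ⟧ X xs
  ⟦ a ⊗ b ⟧ X xs = ⟦ a ⟧ X xs * ⟦ b ⟧ X xs
  ⟦ a ⊖ b ⟧ X xs = ⟦ a ⟧ X xs ∸ ⟦ b ⟧ X xs
  ⟦ sg a ⟧ X xs = sgn (⟦ a ⟧ X xs)
  ⟦ isZero a ⟧ X xs = isz (⟦ a ⟧ X xs)
  ⟦ dec a ⟧ X xs = pred (⟦ a ⟧ X xs)
  ⟦ query a ⟧ X xs = bit (X (⟦ a ⟧ X xs))
  ⟦ call c f es ⟧ X xs = f (⟦ es ⟧* X xs)

  ⟦_⟧* : ∀ {k m} → Vec (Expr k) m → Real → Vec ℕ k → Vec ℕ m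
  ⟦ [] ⟧* X xs = []
  ⟦ e ∷ es ⟧* X xs = ⟦ e ⟧ X xs ∷ ⟦ es ⟧* X xs

mutual
  compile : ∀ {k} → Expr k → Code k
  compile (var i) = proj i
  compile (lit n) = constCode n
  compile (a ⊕ b) = comp addCode (compile a ∷ compile b ∷ [])
  compile (a ⊗ b) = comp mulCode (compile a ∷ compile b ∷ [])
  compile (a ⊖ b) = comp monusCode (compile a ∷ compile b ∷ [])
  compile (sg a) = comp sgCode (compile a ∷ [])
  compile (isZero a) = comp iszCode (compile a ∷ [])
  compile (dec a) = comp predCode (compile a ∷ [])
  compile (query a) = comp orc (compile a ∷ [])
  compile (call c f es) = comp c (compile* es)

  compile* : ∀ {k m} → Vec (Expr k) m → Vec (Code k) m
  compile* [] = []
  compile* (e ∷ es) = compile e ∷ compile* es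

mutual
  WellCalled : Real → ∀ {k} → Expr k → Set
  WellCalled X (var i) = ⊤
  WellCalled X (lit n) = ⊤
  WellCalled X (a ⊕ b) = WellCalled X a × WellCalled X b
  WellCalled X (a ⊗ b) = WellCalled X a × WellCalled X b
  WellCalled X (a ⊖ b) = WellCalled X a × WellCalled X b
  WellCalled X (sg a) = WellCalled X a
  WellCalled X (isZero a) = WellCalled X a
  WellCalled X (dec a) = WellCalled X a
  WellCalled X (query a) = WellCalled X a
  WellCalled X (call c f es) = Computes X c f × WellCalled* X es

  WellCalled* : Real → ∀ {k m} → Vec (Expr k) m → Set
  WellCalled* X [] = ⊤
  WellCalled* X (e ∷ es) = WellCalled X e × WellCalled* X es

mutual
  compile-computes : ∀ {X k} (e : Expr k) → WellCalled X e → Computes X (compile e) (⟦ e ⟧ X)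
  compile-computes (var i) _ xs = eproj i
  compile-computes (lit n) _ xs = constCode-computes n xs
  compile-computes (a ⊕ b) (wa , wb) xs =
    ecomp (compile-computes a wa xs ∷ compile-computes b wb xs ∷ []) (addCode-computes _ _)
  compile-computes (a ⊗ b) (wa , wb) xs =
    ecomp (compile-computes a wa xs ∷ compile-computes b wb xs ∷ []) (mulCode-computes _ _)
  compile-computes (a ⊖ b) (wa , wb) xs =
    ecomp (compile-computes a wa xs ∷ compile-computes b wb xs ∷ []) (monusCode-computes _ _)
  compile-computes (sg a) wa xs = ecomp (compile-computes a wa xs ∷ []) (sgCode-computes _)
  compile-computes (isZero a) wa xs = ecomp (compile-computes a wa xs ∷ []) (iszCode-computes _)
  compile-computes (dec a) wa xs = ecomp (compile-computes a wa xs ∷ []) (predCode-computes _)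
  compile-computes (query a) wa xs = ecomp (compile-computes a wa xs ∷ []) eorc
  compile-computes (call c f es) (c-computes , wes) xs =
    ecomp (compile*-computes es wes xs) (c-computes _)

  compile*-computes : ∀ {X k m} (es : Vec (Expr k) m) → WellCalled* X es →
                      ComputesV X (compile* es) (⟦ es ⟧* X)
  compile*-computes [] _ xs = []
  compile*-computes (e ∷ es) (we , wes) xs = compile-computes e we xs ∷ compile*-computes es wes xs

varsFrom : ∀ {k m} → (Fin m → Fin k) → Vec (Expr k) m
varsFrom {m = zero} f = []
varsFrom {m = suc m} f = var (f zero) ∷ varsFrom (λ i → f (suc i))

varsFrom-value : ∀ {X k m} (f : Fin m → Fin k) xs →
                 ⟦ varsFrom f ⟧* X xs ≡ tabulate (λ i → lookup xs (f i))
varsFrom-value {m = zero} f xs = refl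
varsFrom-value {m = suc m} f xs = cong (_ ∷_) (varsFrom-value (λ i → f (suc i)) xs)

varsFrom-wellCalled : ∀ {X k m} (f : Fin m → Fin k) → WellCalled* X (varsFrom f)
varsFrom-wellCalled {m = zero} f = tt
varsFrom-wellCalled {m = suc m} f = tt , varsFrom-wellCalled (λ i → f (suc i))

-- The last k of j + k variables; used to pass parameters through unchanged.
lastVars : ∀ j {k} → Vec (Expr (j + k)) k
lastVars j = varsFrom (j ↑ʳ_)

lastVars-value : ∀ {X} j {k} (ys : Vec ℕ j) (xs : Vec ℕ k) → ⟦ lastVars j ⟧* X (ys ++ xs) ≡ xs
lastVars-value j ys xs = begin
  ⟦ lastVars j ⟧* _ (ys ++ xs)               ≡⟨ varsFrom-value (j ↑ʳ_) (ys ++ xs) ⟩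
  tabulate (λ i → lookup (ys ++ xs) (j ↑ʳ i)) ≡⟨ tabulate-cong (lookup-++ʳ ys xs) ⟩
  tabulate (lookup xs)                        ≡⟨ tabulate∘lookup xs ⟩
  xs                                          ∎
  where open ≡-Reasoning

lastVars-wellCalled : ∀ {X} j {k} → WellCalled* X (lastVars j {k})
lastVars-wellCalled j = varsFrom-wellCalled (j ↑ʳ_)

IsLeastZero : (ℕ → ℕ) → ℕ → Set
IsLeastZero g n = g n ≡ 0 × (∀ i → i < n → ∃[ w ] g i ≡ suc w)

mu-computes : ∀ {X k} {f : Code (suc k)} {g} xs {n} → Computes X f g →
              IsLeastZero (λ u → g (u ∷ xs)) n → Eval X (mu f) xs n
mu-computes xs f-computes (zero-at-n , positive-below) =
  emu (subst (Eval _ _ _) zero-at-n (f-computes _))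
      (λ i i<n → proj₁ (positive-below i i<n) ,
                 subst (Eval _ _ _) (proj₂ (positive-below i i<n)) (f-computes _))

leastZeroBelow : (g : ℕ → ℕ) → ∀ B → Σ ℕ (IsLeastZero g) ⊎ (∀ i → i < B → ∃[ w ] g i ≡ suc w)
leastZeroBelow g zero = inj₂ (λ i ())
leastZeroBelow g (suc B) with leastZeroBelow g B
... | inj₁ found = inj₁ found
... | inj₂ positive with g B in gB
...   | zero = inj₁ (B , gB , positive)
...   | suc w = inj₂ positive-below-suc
  where
  positive-below-suc : ∀ i → i < suc B → ∃[ w ] g i ≡ suc w
  positive-below-suc i i<sB with m≤n⇒m<n∨m≡n (≤-pred i<sB)
  ... | inj₁ i<B = positive i i<B
  ... | inj₂ refl = w , gB

leastZero : (g : ℕ → ℕ) → ∀ u → g u ≡ 0 → Σ ℕ (IsLeastZero g)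
leastZero g u gu≡0 with leastZeroBelow g (suc u)
... | inj₁ found = found
... | inj₂ positive with positive u ≤-refl
...   | _ , gu≡suc = ⊥-elim (0≢1+n (trans (sym gu≡0) gu≡suc))

-- search g has xs is the least u with g (u ∷ xs) ≡ 0, given that such u
-- always exist; it is computed by μ-search whenever g is computable.  (It is
-- opaque: only its specification matters, never its unfolding.)
HasZeros : ∀ {k} → (Vec ℕ (suc k) → ℕ) → Set
HasZeros g = ∀ xs → ∃[ u ] g (u ∷ xs) ≡ 0

opaque
  leastZeroOf : ∀ {k} (g : Vec ℕ (suc k) → ℕ) → HasZeros g →
                ∀ xs → Σ ℕ (IsLeastZero (λ u → g (u ∷ xs)))
  leastZeroOf g has xs = leastZero (λ u → g (u ∷ xs)) (proj₁ (has xs)) (proj₂ (has xs))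

  search : ∀ {k} (g : Vec ℕ (suc k) → ℕ) → HasZeros g → Vec ℕ k → ℕ
  search g has xs = proj₁ (leastZeroOf g has xs)

  search-computes : ∀ {X k} {f : Code (suc k)} {g} (has : HasZeros g) → Computes X f g →
                    Computes X (mu f) (search g has)
  search-computes {g = g} has f-computes xs = mu-computes xs f-computes (proj₂ (leastZeroOf g has xs))

  search-zero : ∀ {k} (g : Vec ℕ (suc k) → ℕ) (has : HasZeros g) xs → g (search g has xs ∷ xs) ≡ 0
  search-zero g has xs = proj₁ (proj₂ (leastZeroOf g has xs))

pow2Code : Code 1
pow2Code = prec (constCode 1) (compile (lit 2 ⊗ var (suc zero)))

pow2Code-computes : ∀ {X} → Computes X pow2Code (unary (2 ^_))
pow2Code-computes {X} =
  computes-ext powers (prec-computes (constCode-computes 1) (compile-computes doubling (tt , tt)))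
  where
  doubling : Expr 2
  doubling = lit 2 ⊗ var (suc zero)
  powers : ∀ xs → primRec (λ _ → 1) (⟦ doubling ⟧ X) xs ≡ unary (2 ^_) xs
  powers (zero ∷ []) = refl
  powers (suc n ∷ []) = cong (2 *_) (powers (n ∷ []))

-- The remainder of m modulo d by primitive recursion on m: increment, and
-- wrap around to 0 on reaching d.
rem : ℕ → ℕ → ℕ
rem zero d = 0
rem (suc m) d = (1 + rem m d) * sgn (d ∸ (1 + rem m d))

remStep : Expr 3
remStep = (lit 1 ⊕ var (suc zero)) ⊗ sg (var (suc (suc zero)) ⊖ (lit 1 ⊕ var (suc zero)))

remCode : Code 2
remCode = prec zer (compile remStep)

remCode-computes : ∀ {X} → Computes X remCode (binary rem)
remCode-computes {X} =
  computes-ext unfold (prec-computes (λ _ → ezer) (compile-computes remStep ((tt , tt) , (tt , tt , tt))))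
  where
  unfold : ∀ xs → primRec (λ _ → 0) (⟦ remStep ⟧ X) xs ≡ binary rem xs
  unfold (zero ∷ d ∷ []) = refl
  unfold (suc m ∷ d ∷ []) = cong (λ r → (1 + r) * sgn (d ∸ (1 + r))) (unfold (m ∷ d ∷ []))

rem≡% : ∀ m d .{{_ : NonZero d}} → rem m d ≡ m % d
rem≡% zero (suc d) = refl
rem≡% (suc m) (suc d) = step (rem m n) (rem≡% m n)
  where
  n = suc d
  suc-% : suc m % n ≡ suc (m % n) % n
  suc-% = begin
    suc m % n                      ≡⟨ cong (λ z → suc z % n) (m≡m%n+[m/n]*n m n) ⟩
    (suc (m % n) + (m / n) * n) % n ≡⟨ [m+kn]%n≡m%n (suc (m % n)) (m / n) n ⟩
    suc (m % n) % n                ∎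
    where open ≡-Reasoning
  step : ∀ r → r ≡ m % n → (1 + r) * sgn (n ∸ (1 + r)) ≡ suc m % n
  step r r≡ rewrite suc-% | sym r≡ with m≤n⇒m<n∨m≡n (subst (_< n) (sym r≡) (m%n<n m n))
  ... | inj₁ 1+r<n rewrite m<n⇒m%n≡m 1+r<n | sgn-positive (m<n⇒0<n∸m (≤-pred 1+r<n)) =
    *-identityʳ _
  ... | inj₂ 1+r≡n rewrite suc-injective 1+r≡n | n∸n≡0 d =
    trans (*-zeroʳ n) (sym (n%n≡0 n))

-- Dyadic decomposition: every m > 0 is uniquely 2^a (2j+1)

-- dyadic a j is the j-th element of column a; R X is the union of the
-- columns a ∈ X.
dyadic : ℕ → ℕ → ℕ
dyadic a j = 2 ^ a * (2 * j + 1)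

dyadic-positive : ∀ a j → 0 < dyadic a j
dyadic-positive a j = *-mono-≤ (m^n>0 2 a) (m≤n+m 1 (2 * j))

odd≢even : ∀ j k → 2 * j + 1 ≢ 2 * k
odd≢even j k odd≡even = 0≢1+n (trans (sym even%2) (trans (cong (_% 2) (sym odd≡even)) odd%2))
  where
  odd%2 : (2 * j + 1) % 2 ≡ 1
  odd%2 rewrite +-comm (2 * j) 1 | *-comm 2 j = [m+kn]%n≡m%n 1 j 2
  even%2 : (2 * k) % 2 ≡ 0
  even%2 rewrite *-comm 2 k = m*n%n≡0 k 2

parity : ∀ m → ∃[ h ] (m ≡ 2 * h ⊎ m ≡ 2 * h + 1)
parity zero = 0 , inj₁ refl
parity (suc m) with parity m
... | h , inj₁ refl = h , inj₂ (+-comm 1 (2 * h))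
... | h , inj₂ refl = suc h , inj₁ (trans (cong suc (+-comm (2 * h) 1)) (sym (*-suc 2 h)))

-- Existence, by halving m until it is odd (fuel f bounds the halvings).
dyadic-exists : ∀ f m → m ≤ f → 0 < m → ∃[ a ] ∃[ j ] m ≡ dyadic a j
dyadic-exists zero .zero z≤n ()
dyadic-exists (suc f) m m≤f 0<m with parity m
... | h , inj₂ refl = 0 , h , sym (+-identityʳ _)
... | zero , inj₁ refl = ⊥-elim (<-irrefl refl 0<m)
... | suc h , inj₁ refl with dyadic-exists f (suc h) (≤-pred (≤-trans (m<m+n (suc h) z<s) m≤f)) z<s
...   | a , j , h≡ = suc a , j , trans (cong (2 *_) h≡) (sym (*-assoc 2 (2 ^ a) (2 * j + 1)))

-- Uniqueness, by comparing parities.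
dyadic-injective : ∀ a b j k → dyadic a j ≡ dyadic b k → a ≡ b × j ≡ k
dyadic-injective zero zero j k eq =
  refl , *-cancelˡ-≡ j k 2 (+-cancelʳ-≡ 1 _ _ (trans (sym (+-identityʳ _)) (trans eq (+-identityʳ _))))
dyadic-injective zero (suc b) j k eq =
  ⊥-elim (odd≢even j (dyadic b k) (trans (sym (+-identityʳ _)) (trans eq (*-assoc 2 (2 ^ b) _))))
dyadic-injective (suc a) zero j k eq =
  ⊥-elim (odd≢even k (dyadic a j) (trans (sym (+-identityʳ _)) (trans (sym eq) (*-assoc 2 (2 ^ a) _))))
dyadic-injective (suc a) (suc b) j k eq
  with dyadic-injective a b j k
         (*-cancelˡ-≡ _ _ 2 (trans (sym (*-assoc 2 (2 ^ a) _)) (trans eq (*-assoc 2 (2 ^ b) _))))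
... | refl , j≡k = refl , j≡k

decomposition : ∀ m → Σ (ℕ × ℕ) λ (a , j) → m ≡ 0 ⊎ m ≡ dyadic a j
decomposition zero = (0 , 0) , inj₁ refl
decomposition (suc m) with dyadic-exists (suc m) (suc m) ≤-refl z<s
... | a , j , eq = (a , j) , inj₂ eq

-- m = dyadic (col m) (row m) for m > 0; both are 0 at 0.
opaque
  col row : ℕ → ℕ
  col m = proj₁ (proj₁ (decomposition m))
  row m = proj₂ (proj₁ (decomposition m))

  col-row : ∀ m → 0 < m → m ≡ dyadic (col m) (row m)
  col-row m 0<m with decomposition m
  ... | _ , inj₂ eq = eq
  ... | _ , inj₁ refl = ⊥-elim (<-irrefl refl 0<m)

  col-row-dyadic : ∀ a j → col (dyadic a j) ≡ a × row (dyadic a j) ≡ j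
  col-row-dyadic a j with dyadic-injective a _ j _ (col-row (dyadic a j) (dyadic-positive a j))
  ... | a≡ , j≡ = sym a≡ , sym j≡

  col-zero : col 0 ≡ 0
  col-zero = refl

  row-zero : row 0 ≡ 0
  row-zero = refl

col-dyadic : ∀ a j → col (dyadic a j) ≡ a
col-dyadic a j = proj₁ (col-row-dyadic a j)

row-dyadic : ∀ a j → row (dyadic a j) ≡ j
row-dyadic a j = proj₂ (col-row-dyadic a j)

-- col m is the least a with 2^(a+1) ∤ m, which is how colCode finds it.
2^[1+a]∤dyadic : ∀ a j → ¬ (2 ^ suc a ∣ dyadic a j)
2^[1+a]∤dyadic a j (divides q eq) = odd≢even j q (*-cancelˡ-≡ _ _ (2 ^ a) {{m^n≢0 2 a}}
  (trans eq (solve 2 (λ q p → q :* (con 2 :* p) := p :* (con 2 :* q)) refl q (2 ^ a))))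

2^[1+i]∣2^[1+i+t] : ∀ i t x → 2 ^ suc i ∣ 2 ^ (suc i + t) * x
2^[1+i]∣2^[1+i+t] i t x = divides (2 ^ t * x) (trans (cong (_* x) (^-distribˡ-+-* 2 (suc i) t))
  (solve 3 (λ p r x → (p :* r) :* x := (r :* x) :* p) refl (2 ^ suc i) (2 ^ t) x))

-- colTest (a ∷ m ∷ []) is 0 iff 2^(a+1) ∤ m or m = 0.
colTest : Expr 2
colTest = isZero (call remCode (binary rem)
                       (var (suc zero) ∷ call pow2Code (unary (2 ^_)) (lit 1 ⊕ var zero ∷ []) ∷ [])
                  ⊕ isZero (var (suc zero)))

colTest-wellCalled : ∀ {X} → WellCalled X colTest
colTest-wellCalled = (remCode-computes , tt , (pow2Code-computes , (tt , tt) , tt) , tt) , tt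

colCode : Code 1
colCode = mu (compile colTest)

colCode-computes : ∀ {X} → Computes X colCode (unary col)
colCode-computes (zero ∷ []) =
  subst (Eval _ colCode (zero ∷ [])) (sym col-zero)
        (mu-computes _ (compile-computes colTest colTest-wellCalled) (refl , λ i ()))
colCode-computes (suc m ∷ []) =
  mu-computes _ (compile-computes colTest colTest-wellCalled) (zero-at-col , positive-below)
  where
  a = col (suc m)
  m≡ = col-row (suc m) z<s
  rem-2^ : ∀ i → rem (suc m) (2 ^ suc i) ≡ _%_ (suc m) (2 ^ suc i) {{m^n≢0 2 (suc i)}}
  rem-2^ i = rem≡% (suc m) (2 ^ suc i) {{m^n≢0 2 (suc i)}}
  zero-at-col : isz (rem (suc m) (2 ^ suc a) + 0) ≡ 0
  zero-at-col = isz-nonzero λ r≡0 → 2^[1+a]∤dyadic a (row (suc m))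
    (subst (2 ^ suc a ∣_) m≡ (m%n≡0⇒n∣m (suc m) (2 ^ suc a) {{m^n≢0 2 (suc a)}}
      (trans (sym (rem-2^ a)) (trans (sym (+-identityʳ _)) r≡0))))
  positive-below : ∀ i → i < a → ∃[ w ] isz (rem (suc m) (2 ^ suc i) + 0) ≡ suc w
  positive-below i i<a with m≤n⇒∃[o]m+o≡n i<a
  ... | t , i+t≡ = 0 , cong isz (trans (+-identityʳ _) (trans (rem-2^ i)
        (n∣m⇒m%n≡0 (suc m) (2 ^ suc i) {{m^n≢0 2 (suc i)}}
          (subst (2 ^ suc i ∣_) (sym (trans m≡ (cong (λ z → dyadic z (row (suc m))) (sym i+t≡))))
                 (2^[1+i]∣2^[1+i+t] i t _)))))


-- row m is the least j with m ≤ 2^(col m) (2j+1).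
rowTest : Expr 2
rowTest = var (suc zero) ⊖ call pow2Code (unary (2 ^_)) (call colCode (unary col) (var (suc zero) ∷ []) ∷ [])
                           ⊗ (lit 2 ⊗ var zero ⊕ lit 1)

rowTest-wellCalled : ∀ {X} → WellCalled X rowTest
rowTest-wellCalled = tt , (pow2Code-computes , (colCode-computes , tt , tt) , tt) , (tt , tt) , tt

rowCode : Code 1
rowCode = mu (compile rowTest)

rowCode-computes : ∀ {X} → Computes X rowCode (unary row)
rowCode-computes (zero ∷ []) =
  subst (Eval _ rowCode (zero ∷ [])) (sym row-zero)
        (mu-computes _ (compile-computes rowTest rowTest-wellCalled) (0∸n≡0 (2 ^ col 0 * 1) , λ i ()))
rowCode-computes (suc m ∷ []) =
  mu-computes _ (compile-computes rowTest rowTest-wellCalled) (zero-at-row , positive-below)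
  where
  a = col (suc m)
  j = row (suc m)
  m≡ = col-row (suc m) z<s
  zero-at-row : suc m ∸ dyadic a j ≡ 0
  zero-at-row = trans (cong (_∸ dyadic a j) m≡) (n∸n≡0 (dyadic a j))
  positive-below : ∀ i → i < j → ∃[ w ] suc m ∸ dyadic a i ≡ suc w
  positive-below i i<j = positive (subst (λ z → 0 < z ∸ dyadic a i) (sym m≡)
      (m<n⇒0<n∸m (*-monoʳ-< (2 ^ a) {{m^n≢0 2 a}} (+-monoˡ-< 1 (*-monoʳ-< 2 i<j)))))
    where
    positive : ∀ {x} → 0 < x → ∃[ w ] x ≡ suc w
    positive {suc x} _ = x , refl

-- A step-counting interpreter

Eventually : (ℕ → Set) → Set
Eventually P = Σ ℕ λ s₀ → ∀ s → s₀ ≤ s → P s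

eventually-both : ∀ {P Q : ℕ → Set} → Eventually P → Eventually Q → Eventually (λ s → P s × Q s)
eventually-both (s₁ , P≥) (s₂ , Q≥) =
  s₁ + s₂ , λ s s₁+s₂≤s → P≥ s (≤-trans (m≤m+n s₁ s₂) s₁+s₂≤s) ,
                          Q≥ s (≤-trans (m≤n+m s₂ s₁) s₁+s₂≤s)

eventually-map : ∀ {P Q : ℕ → Set} → (∀ {s} → P s → Q s) → Eventually P → Eventually Q
eventually-map P⇒Q (s₀ , P≥) = s₀ , λ s s₀≤s → P⇒Q (P≥ s s₀≤s)

eventually-below : ∀ (P : ℕ → ℕ → Set) n → (∀ i → i < n → Eventually (P i)) →
                   Eventually (λ s → ∀ i → i < n → P i s)
eventually-below P zero _ = 0 , λ _ _ i ()
eventually-below P (suc n) ev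
  with eventually-both (eventually-below P n (λ i i<n → ev i (≤-trans i<n (n≤1+n n)))) (ev n ≤-refl)
... | s₀ , both = s₀ , λ s s₀≤s i i<1+n → below-suc s (both s s₀≤s) i i<1+n
  where
  below-suc : ∀ s → (∀ i → i < n → P i s) × P n s → ∀ i → i < suc n → P i s
  below-suc s (below , at-n) i i<1+n with m≤n⇒m<n∨m≡n (≤-pred i<1+n)
  ... | inj₁ i<n = below i i<n
  ... | inj₂ refl = at-n

-- One step of a clocked μ-search over candidates t = 0, 1, ...  The state
-- is 0 while searching, 1 once a candidate failed to converge within the
-- budget, and r + 2 once the candidate r has been found to yield 0; w is the
-- clocked value of candidate t.
searchStep : ℕ → ℕ → ℕ → ℕ
searchStep b w t = b + isz b * (isz w + sgn w * isz (pred w) * (t + 2))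

searchStep-done : ∀ b w t → searchStep (suc b) w t ≡ suc b
searchStep-done b w t = +-identityʳ (suc b)

searchStep-found : ∀ t → searchStep 0 1 t ≡ suc (suc t)
searchStep-found t = trans (+-identityʳ _) (trans (+-identityʳ _) (+-comm t 2))

module Clocked (Y : Real) where

  -- clocked c s xs is suc u if the computation of c on xs with oracle Y
  -- yields u using budget s, and 0 otherwise.  The budget bounds the
  -- number of candidates each μ-search may inspect.
  mutual
    clocked : ∀ {k} → Code k → ℕ → Vec ℕ k → ℕ
    clocked zer s xs = 1
    clocked succ s (n ∷ []) = suc (suc n)
    clocked (proj i) s xs = suc (lookup xs i)
    clocked orc s (n ∷ []) = suc (bit (Y n))
    clocked (comp f gs) s xs = allConverged gs s xs * clocked f s (outputs gs s xs)
    clocked (prec f g) s (n ∷ xs) = clockedRec f g s n xs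
    clocked (mu f) s xs = pred (clockedSearch f s xs s)

    allConverged : ∀ {k m} → Vec (Code k) m → ℕ → Vec ℕ k → ℕ
    allConverged [] s xs = 1
    allConverged (g ∷ gs) s xs = sgn (clocked g s xs) * allConverged gs s xs

    outputs : ∀ {k m} → Vec (Code k) m → ℕ → Vec ℕ k → Vec ℕ m
    outputs [] s xs = []
    outputs (g ∷ gs) s xs = pred (clocked g s xs) ∷ outputs gs s xs

    clockedRec : ∀ {k} → Code k → Code (suc (suc k)) → ℕ → ℕ → Vec ℕ k → ℕ
    clockedRec f g s zero xs = clocked f s xs
    clockedRec f g s (suc n) xs =
      sgn (clockedRec f g s n xs) * clocked g s (n ∷ pred (clockedRec f g s n xs) ∷ xs)

    clockedSearch : ∀ {k} → Code (suc k) → ℕ → Vec ℕ k → ℕ → ℕ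
    clockedSearch f s xs zero = 0
    clockedSearch f s xs (suc t) = searchStep (clockedSearch f s xs t) (clocked f s (t ∷ xs)) t

  allConverged-01 : ∀ {k m} (gs : Vec (Code k) m) s xs →
                    allConverged gs s xs ≡ 0 ⊎ allConverged gs s xs ≡ 1
  allConverged-01 [] s xs = inj₂ refl
  allConverged-01 (g ∷ gs) s xs with clocked g s xs | allConverged-01 gs s xs
  ... | zero | _ = inj₁ refl
  ... | suc _ | inj₁ ≡0 = inj₁ (trans (+-identityʳ _) ≡0)
  ... | suc _ | inj₂ ≡1 = inj₂ (trans (+-identityʳ _) ≡1)

  Rejected : ∀ {k} → Code (suc k) → ℕ → Vec ℕ k → ℕ → Set
  Rejected f s xs i = ∃[ w ] clocked f s (i ∷ xs) ≡ suc (suc w)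

  clockedSearch-invariant : ∀ {k} (f : Code (suc k)) s xs t →
    (clockedSearch f s xs t ≡ 0 → ∀ i → i < t → Rejected f s xs i) ×
    (∀ r → clockedSearch f s xs t ≡ suc (suc r) →
           clocked f s (r ∷ xs) ≡ 1 × (∀ i → i < r → Rejected f s xs i))
  clockedSearch-invariant f s xs zero = (λ _ i ()) , (λ r ())
  clockedSearch-invariant f s xs (suc t)
    with clockedSearch-invariant f s xs t | clockedSearch f s xs t in state | clocked f s (t ∷ xs) in value
  ... | _ , found | suc b | w rewrite searchStep-done b w t = (λ ()) , λ r eq → found r (trans state eq)
  ... | _ | zero | zero = (λ ()) , (λ r ())
  ... | searching , _ | zero | suc zero rewrite searchStep-found t =
    (λ ()) , λ { r refl → value , searching state }
  ... | searching , _ | zero | suc (suc w) = (λ _ i i<1+t → rejected i i<1+t) , (λ r ())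
    where
    rejected : ∀ i → i < suc t → Rejected f s xs i
    rejected i i<1+t with m≤n⇒m<n∨m≡n (≤-pred i<1+t)
    ... | inj₁ i<t = searching state i i<t
    ... | inj₂ refl = w , value

  mutual
    clocked-sound : ∀ {k} (c : Code k) s xs u → clocked c s xs ≡ suc u → Eval Y c xs u
    clocked-sound zer s xs .0 refl = ezer
    clocked-sound succ s (n ∷ []) .(suc n) refl = esucc
    clocked-sound (proj i) s xs _ refl = eproj i
    clocked-sound orc s (n ∷ []) _ refl = eorc
    clocked-sound (comp f gs) s xs u eq with allConverged-01 gs s xs
    ... | inj₁ ≡0 rewrite ≡0 = ⊥-elim (0≢1+n eq)
    ... | inj₂ ≡1 rewrite ≡1 =
      ecomp (outputs-sound gs s xs ≡1) (clocked-sound f s _ u (trans (sym (+-identityʳ _)) eq))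
    clocked-sound (prec f g) s (n ∷ xs) u eq = clockedRec-sound f g s n xs u eq
    clocked-sound (mu f) s xs u eq with clockedSearch f s xs s in state
    clocked-sound (mu f) s xs u () | zero
    clocked-sound (mu f) s xs u () | suc zero
    clocked-sound (mu f) s xs .r refl | suc (suc r)
      with proj₂ (clockedSearch-invariant f s xs s) r state
    ... | zero-at-r , rejected =
      emu (clocked-sound f s _ 0 zero-at-r)
          (λ i i<r → proj₁ (rejected i i<r) , clocked-sound f s _ _ (proj₂ (rejected i i<r)))

    outputs-sound : ∀ {k m} (gs : Vec (Code k) m) s xs → allConverged gs s xs ≡ 1 →
                    EvalV Y gs xs (outputs gs s xs)
    outputs-sound [] s xs _ = []
    outputs-sound (g ∷ gs) s xs all≡1 with clocked g s xs in eq
    ... | zero = ⊥-elim (0≢1+n all≡1)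
    ... | suc y = clocked-sound g s xs y eq ∷ outputs-sound gs s xs (trans (sym (+-identityʳ _)) all≡1)

    clockedRec-sound : ∀ {k} (f : Code k) g s n xs u → clockedRec f g s n xs ≡ suc u →
                       Eval Y (prec f g) (n ∷ xs) u
    clockedRec-sound f g s zero xs u eq = eprec0 (clocked-sound f s xs u eq)
    clockedRec-sound f g s (suc n) xs u eq with clockedRec f g s n xs in previous
    ... | zero = ⊥-elim (0≢1+n eq)
    ... | suc w = eprecS (clockedRec-sound f g s n xs w previous)
                         (clocked-sound g s _ u (trans (sym (+-identityʳ _)) eq))

  clockedSearch-run : ∀ {k} (f : Code (suc k)) s xs n → clocked f s (n ∷ xs) ≡ 1 →
                      (∀ i → i < n → Rejected f s xs i) →
                      ∀ t → (t ≤ n → clockedSearch f s xs t ≡ 0) ×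
                            (n < t → clockedSearch f s xs t ≡ suc (suc n))
  clockedSearch-run f s xs n zero-at-n rejected zero = (λ _ → refl) , (λ ())
  clockedSearch-run f s xs n zero-at-n rejected (suc t) = searching , found
    where
    ih = clockedSearch-run f s xs n zero-at-n rejected t
    searching : suc t ≤ n → clockedSearch f s xs (suc t) ≡ 0
    searching 1+t≤n with rejected t 1+t≤n
    ... | w , value rewrite proj₁ ih (≤-trans (n≤1+n t) 1+t≤n) | value = refl
    found : n < suc t → clockedSearch f s xs (suc t) ≡ suc (suc n)
    found n<1+t with m≤n⇒m<n∨m≡n (≤-pred n<1+t)
    ... | inj₁ n<t rewrite proj₂ ih n<t = searchStep-done (suc n) (clocked f s (t ∷ xs)) t
    ... | inj₂ refl rewrite proj₁ ih ≤-refl | zero-at-n = searchStep-found t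

  mutual
    clocked-complete : ∀ {k} {c : Code k} {xs u} → Eval Y c xs u →
                       Eventually (λ s → clocked c s xs ≡ suc u)
    clocked-complete ezer = 0 , λ _ _ → refl
    clocked-complete esucc = 0 , λ _ _ → refl
    clocked-complete (eproj i) = 0 , λ _ _ → refl
    clocked-complete eorc = 0 , λ _ _ → refl
    clocked-complete (ecomp {f = f} ds d) =
      eventually-map (λ {s} ((all≡1 , outs≡) , f≡) →
                        trans (cong₂ _*_ all≡1 (trans (cong (clocked f s) outs≡) f≡)) (+-identityʳ _))
                     (eventually-both (outputs-complete ds) (clocked-complete d))
    clocked-complete (eprec0 d) = clocked-complete d
    clocked-complete (eprecS {g = g} {xs = xs} {n = m} d e) =
      eventually-map (λ {s} (rec≡ , g≡) →
                        trans (cong (λ p → sgn p * clocked g s (m ∷ pred p ∷ xs)) rec≡)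
                              (trans (+-identityʳ _) g≡))
                     (eventually-both (clocked-complete d) (clocked-complete e))
    clocked-complete {xs = xs} (emu {f = f} {n = n} d below) =
      eventually-map (λ {s} ((zero-at-n , rejected) , n<s) →
                        cong pred (proj₂ (clockedSearch-run f s xs n zero-at-n rejected s) n<s))
                     (eventually-both (eventually-both (clocked-complete d) rejected-below)
                                      (suc n , λ s n<s → n<s))
      where
      rejected-below : Eventually (λ s → ∀ i → i < n → Rejected f s xs i)
      rejected-below = eventually-below (λ i s → Rejected f s xs i) n λ i i<n →
        eventually-map (proj₁ (below i i<n) ,_) (clocked-complete (proj₂ (below i i<n)))

    outputs-complete : ∀ {k m} {gs : Vec (Code k) m} {xs ys} → EvalV Y gs xs ys →
                       Eventually (λ s → allConverged gs s xs ≡ 1 × outputs gs s xs ≡ ys)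
    outputs-complete [] = 0 , λ _ _ → refl , refl
    outputs-complete (d ∷ ds) =
      eventually-map (λ (g≡ , all≡1 , outs≡) →
                        cong₂ _*_ (cong sgn g≡) all≡1 , cong₂ _∷_ (cong pred g≡) outs≡)
                     (eventually-both (clocked-complete d) (outputs-complete ds))

  clockedFn : ∀ {k} → Code k → Vec ℕ (suc k) → ℕ
  clockedFn c (s ∷ xs) = clocked c s xs

  recFn : ∀ {k} → Code k → Code (suc (suc k)) → Vec ℕ (suc (suc k)) → ℕ
  recFn f g (n ∷ s ∷ xs) = clockedRec f g s n xs

  searchFn : ∀ {k} → Code (suc k) → Vec ℕ (suc (suc k)) → ℕ
  searchFn f (t ∷ s ∷ xs) = clockedSearch f s xs t

  mutual
    clockCode : ∀ {k} → Code k → Code (suc k)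
    clockCode c = compile (clockExpr c)

    clockExpr : ∀ {k} → Code k → Expr (suc k)
    clockExpr zer = lit 1
    clockExpr succ = lit 2 ⊕ var (suc zero)
    clockExpr (proj i) = lit 1 ⊕ var (suc i)
    clockExpr orc = lit 1 ⊕ query (var (suc zero))
    clockExpr (comp f gs) =
      convergedExpr gs ⊗ call (clockCode f) (clockedFn f) (var zero ∷ outputsExpr gs)
    clockExpr (prec f g) =
      call (prec (clockCode f) (compile (recStepExpr g))) (recFn f g)
           (var (suc zero) ∷ var zero ∷ lastVars 2)
    clockExpr (mu f) =
      dec (call (prec zer (compile (searchStepExpr f))) (searchFn f) (var zero ∷ var zero ∷ lastVars 1))

    -- The step computing clockedRec; variables n, previous value, s, xs.
    recStepExpr : ∀ {k} → Code (suc (suc k)) → Expr (suc (suc (suc k)))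
    recStepExpr g = sg (var (suc zero))
                    ⊗ call (clockCode g) (clockedFn g)
                           (var (suc (suc zero)) ∷ var zero ∷ dec (var (suc zero)) ∷ lastVars 3)

    -- The step computing clockedSearch; variables t, previous state, s, xs.
    searchStepExpr : ∀ {k} → Code (suc k) → Expr (suc (suc (suc k)))
    searchStepExpr f = var (suc zero) ⊕ isZero (var (suc zero))
                         ⊗ (isZero candidate ⊕ sg candidate ⊗ isZero (dec candidate) ⊗ (var zero ⊕ lit 2))
      where
      candidate = call (clockCode f) (clockedFn f) (var (suc (suc zero)) ∷ var zero ∷ lastVars 3)

    convergedExpr : ∀ {k m} → Vec (Code k) m → Expr (suc k)
    convergedExpr [] = lit 1
    convergedExpr (g ∷ gs) = sg (call (clockCode g) (clockedFn g) (lastVars 0)) ⊗ convergedExpr gs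

    outputsExpr : ∀ {k m} → Vec (Code k) m → Vec (Expr (suc k)) m
    outputsExpr [] = []
    outputsExpr (g ∷ gs) = dec (call (clockCode g) (clockedFn g) (lastVars 0)) ∷ outputsExpr gs

  converged-value : ∀ {k m} (gs : Vec (Code k) m) s xs →
                    ⟦ convergedExpr gs ⟧ Y (s ∷ xs) ≡ allConverged gs s xs
  converged-value [] s xs = refl
  converged-value (g ∷ gs) s xs =
    cong₂ (λ ys r → sgn (clockedFn g ys) * r) (lastVars-value 0 [] (s ∷ xs)) (converged-value gs s xs)

  outputs-value : ∀ {k m} (gs : Vec (Code k) m) s xs → ⟦ outputsExpr gs ⟧* Y (s ∷ xs) ≡ outputs gs s xs
  outputs-value [] s xs = refl
  outputs-value (g ∷ gs) s xs =
    cong₂ (λ ys r → pred (clockedFn g ys) ∷ r) (lastVars-value 0 [] (s ∷ xs)) (outputs-value gs s xs)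

  mutual
    clockCode-computes : ∀ {k} (c : Code k) → Computes Y (clockCode c) (clockedFn c)
    clockCode-computes zer = computes-ext (λ { (s ∷ xs) → refl }) (compile-computes (lit 1) tt)
    clockCode-computes succ =
      computes-ext (λ { (s ∷ n ∷ []) → refl }) (compile-computes (clockExpr succ) (tt , tt))
    clockCode-computes (proj i) =
      computes-ext (λ { (s ∷ xs) → refl }) (compile-computes (clockExpr (proj i)) (tt , tt))
    clockCode-computes orc =
      computes-ext (λ { (s ∷ n ∷ []) → refl }) (compile-computes (clockExpr orc) (tt , tt))
    clockCode-computes (comp f gs) =
      computes-ext value (compile-computes (clockExpr (comp f gs))
                            (converged-wellCalled gs , clockCode-computes f , tt , outputs-wellCalled gs))
      where
      value : ∀ xs → ⟦ clockExpr (comp f gs) ⟧ Y xs ≡ clockedFn (comp f gs) xs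
      value (s ∷ xs) rewrite converged-value gs s xs | outputs-value gs s xs = refl
    clockCode-computes (prec f g) =
      computes-ext value (compile-computes (clockExpr (prec f g))
                            (clockedRec-computes f g , tt , tt , lastVars-wellCalled 2))
      where
      value : ∀ xs → ⟦ clockExpr (prec f g) ⟧ Y xs ≡ clockedFn (prec f g) xs
      value (s ∷ n ∷ xs) rewrite lastVars-value {Y} 2 (s ∷ n ∷ []) xs = refl
    clockCode-computes (mu f) =
      computes-ext value (compile-computes (clockExpr (mu f))
                            (clockedSearch-computes f , tt , tt , lastVars-wellCalled 1))
      where
      value : ∀ xs → ⟦ clockExpr (mu f) ⟧ Y xs ≡ clockedFn (mu f) xs
      value (s ∷ xs) rewrite lastVars-value {Y} 1 (s ∷ []) xs = refl

    clockedRec-computes : ∀ {k} (f : Code k) g →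
                         Computes Y (prec (clockCode f) (compile (recStepExpr g))) (recFn f g)
    clockedRec-computes f g =
      computes-ext unfold (prec-computes (clockCode-computes f) (compile-computes (recStepExpr g) wellCalled))
      where
      wellCalled = tt , clockCode-computes g , tt , tt , tt , lastVars-wellCalled 3
      unfold : ∀ xs → primRec (clockedFn f) (⟦ recStepExpr g ⟧ Y) xs ≡ recFn f g xs
      unfold (zero ∷ s ∷ xs) = refl
      unfold (suc n ∷ s ∷ xs)
        rewrite unfold (n ∷ s ∷ xs) | lastVars-value {Y} 3 (n ∷ clockedRec f g s n xs ∷ s ∷ []) xs = refl

    clockedSearch-computes : ∀ {k} (f : Code (suc k)) →
                       Computes Y (prec zer (compile (searchStepExpr f))) (searchFn f)
    clockedSearch-computes f =
      computes-ext unfold (prec-computes (λ _ → ezer) (compile-computes (searchStepExpr f) wellCalled))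
      where
      candidate = clockCode-computes f , tt , tt , lastVars-wellCalled 3
      wellCalled = tt , tt , candidate , (candidate , candidate) , tt , tt
      unfold : ∀ xs → primRec (λ _ → 0) (⟦ searchStepExpr f ⟧ Y) xs ≡ searchFn f xs
      unfold (zero ∷ s ∷ xs) = refl
      unfold (suc t ∷ s ∷ xs)
        rewrite unfold (t ∷ s ∷ xs) | lastVars-value {Y} 3 (t ∷ clockedSearch f s xs t ∷ s ∷ []) xs = refl

    converged-wellCalled : ∀ {k m} (gs : Vec (Code k) m) → WellCalled Y (convergedExpr gs)
    converged-wellCalled [] = tt
    converged-wellCalled (g ∷ gs) = (clockCode-computes g , lastVars-wellCalled 0) , converged-wellCalled gs

    outputs-wellCalled : ∀ {k m} (gs : Vec (Code k) m) → WellCalled* Y (outputsExpr gs)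
    outputs-wellCalled [] = tt
    outputs-wellCalled (g ∷ gs) = (clockCode-computes g , lastVars-wellCalled 0) , outputs-wellCalled gs


-- Density: a density-1 set meets every column

∈-delete : ∀ {y x : ℕ} (A : List ℕ) {B} → y ∈ A List.++ x ∷ B → y ≢ x → y ∈ A List.++ B
∈-delete [] (here y≡x) y≢x = ⊥-elim (y≢x y≡x)
∈-delete [] (there y∈B) y≢x = y∈B
∈-delete (a ∷ A) (here y≡a) y≢x = here y≡a
∈-delete (a ∷ A) (there y∈) y≢x = there (∈-delete A y∈ y≢x)

unique-⊆-length : ∀ (L S : List ℕ) → Unique L → All (_∈ S) L → length L ≤ length S
unique-⊆-length [] S _ _ = z≤n
unique-⊆-length (x ∷ L) S (x∉L ∷ unique) (x∈S ∷ L⊆S) with ∈-∃++ x∈S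
... | A , B , refl = subst (suc (length L) ≤_) (sym length-deleted)
      (s≤s (unique-⊆-length L (A List.++ B) unique
             (All.zipWith (λ (y∈ , x≢y) → ∈-delete A y∈ (λ y≡x → x≢y (sym y≡x))) (L⊆S , x∉L))))
  where
  length-deleted : length (A List.++ x ∷ B) ≡ suc (length (A List.++ B))
  length-deleted = trans (length-++ A) (trans (+-suc (length A) (length B)) (cong suc (sym (length-++ A))))

unique-below-length : ∀ n (L : List ℕ) → Unique L → All (_< n) L → length L ≤ n
unique-below-length n L unique below =
  subst (length L ≤_) (length-upTo n) (unique-⊆-length L (upTo n) unique (All.map ∈-upTo⁺ below))

everywhere-density1 : (P : ℕ → Set) → (∀ n → P n) → Density1 P
everywhere-density1 P everywhere k =
  0 , λ n _ → n , (upTo n , Unique.upTo⁺ n , All.tabulate (λ {x} x∈ → ∈-upTo⁻ x∈ , everywhere x) ,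
                   ≤-reflexive (sym (length-upTo n))) ,
              subst (_≤ n) (sym (trans (cong (suc k *_) (n∸n≡0 n)) (*-zeroʳ (suc k)))) z≤n

searchColumn : ∀ (L : List ℕ) b r → (∃[ j ] dyadic b j ∈ L) ⊎ (∀ j → j < r → dyadic b j ∉ L)
searchColumn L b zero = inj₂ (λ j ())
searchColumn L b (suc r) with searchColumn L b r
... | inj₁ found = inj₁ found
... | inj₂ none with dyadic b r ∈? L
...   | yes r∈L = inj₁ (r , r∈L)
...   | no r∉L = inj₂ none-below-suc
  where
  none-below-suc : ∀ j → j < suc r → dyadic b j ∉ L
  none-below-suc j j<1+r with m≤n⇒m<n∨m≡n (≤-pred j<1+r)
  ... | inj₁ j<r = none j j<r
  ... | inj₂ refl = r∉L

column-bound : ∀ b r j → j < r → dyadic b j < 2 ^ suc b * r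
column-bound b r j j<r =
  subst (dyadic b j <_) (solve 2 (λ p r → p :* (con 2 :* r) := (con 2 :* p) :* r) refl (2 ^ b) r)
        (*-monoʳ-< (2 ^ b) {{m^n≢0 2 b}} 2j+1<2r)
  where
  2j+1<2r : 2 * j + 1 < 2 * r
  2j+1<2r = subst (_≤ 2 * r) (solve 1 (λ j → con 2 :* (con 1 :+ j) := con 1 :+ (con 2 :* j :+ con 1)) refl j)
                  (*-monoʳ-≤ 2 j<r)

avoiding-column-length : ∀ b r (L : List ℕ) → Unique L → All (_< 2 ^ suc b * r) L →
                         (∀ j → j < r → dyadic b j ∉ L) → length L + r ≤ 2 ^ suc b * r
avoiding-column-length b r L unique below avoids =
  subst (_≤ 2 ^ suc b * r) length-L++C
        (unique-below-length _ (L List.++ C) (Unique.++⁺ unique unique-C disjoint) below-L++C)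
  where
  C = map (dyadic b) (upTo r)
  unique-C : Unique C
  unique-C = Unique.map⁺ (λ eq → proj₂ (dyadic-injective b b _ _ eq)) (Unique.upTo⁺ r)
  disjoint : Disjoint L C
  disjoint (x∈L , x∈C) with ∈-map⁻ (dyadic b) {xs = upTo r} x∈C
  ... | j , j∈ , refl = avoids j (∈-upTo⁻ j∈) x∈L
  below-L++C : All (_< 2 ^ suc b * r) (L List.++ C)
  below-L++C = All.++⁺ below (All.map⁺ (All.tabulate (λ j∈ → column-bound b r _ (∈-upTo⁻ j∈))))
  length-L++C : length (L List.++ C) ≡ length L + r
  length-L++C = trans (length-++ L) (cong (length L +_) (trans (length-map (dyadic b) (upTo r)) (length-upTo r)))

-- Take the density bound for the
-- proportion 1/K with K = 2^(b+2) at n = 2^(b+1) r, r large: if the set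
-- missed the first r points of column b, the r missing points would make
-- K r = 2n ≤ (K+1) · #missing ≤ n, which is impossible.
meets-every-column : (A : ℕ → Set) → Density1 A → ∀ b → ∃[ j ] A (dyadic b j)
meets-every-column A dense b with dense (2 ^ suc (suc b))
... | N , bound with bound (2 ^ suc b * suc N) N≤n
  where
  N≤n : N ≤ 2 ^ suc b * suc N
  N≤n = ≤-trans (n≤1+n N) (m≤n*m (suc N) (2 ^ suc b) {{m^n≢0 2 (suc b)}})
... | c , (L , unique , members , c≤length) , few-missing with searchColumn L b (suc N)
... | inj₁ (j , j∈L) = j , proj₂ (All.lookup members j∈L)
... | inj₂ avoids = ⊥-elim (<-irrefl refl (begin-strict
    n                   <⟨ n<2n ⟩
    2 * n               ≡⟨ *-assoc 2 (2 ^ suc b) r ⟨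
    K * r               ≤⟨ *-monoˡ-≤ r (n≤1+n K) ⟩
    suc K * r           ≤⟨ *-monoʳ-≤ (suc K) r≤missing ⟩
    suc K * (n ∸ c)     ≤⟨ few-missing ⟩
    n                   ∎))
  where
  open ≤-Reasoning
  r = suc N
  n = 2 ^ suc b * r
  K = 2 ^ suc (suc b)
  r≤missing : r ≤ n ∸ c
  r≤missing = ≤-trans (≤-reflexive (sym (m+n∸m≡n c r)))
    (∸-monoˡ-≤ c (≤-trans (+-monoˡ-≤ r c≤length)
                         (avoiding-column-length b r L unique (All.map proj₁ members) avoids)))
  n<2n : n < 2 * n
  n<2n = subst (n <_) (cong (n +_) (sym (+-identityʳ n)))
               (m<m+n n (*-mono-≤ (m^n>0 2 (suc b)) (s≤s z≤n)))

suc-∸1 : ∀ m → 0 < m → suc (m ∸ 1) ≡ m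
suc-∸1 (suc m) _ = refl

-- pair a b + 1 = dyadic a b, so the components are recovered by col and row.
unpair₁ unpair₂ : ℕ → ℕ
unpair₁ u = col (suc u)
unpair₂ u = row (suc u)

suc-pair : ∀ a b → suc (pair a b) ≡ dyadic a b
suc-pair a b = suc-∸1 (dyadic a b) (dyadic-positive a b)

unpair₁-pair : ∀ a b → unpair₁ (pair a b) ≡ a
unpair₁-pair a b = trans (cong col (suc-pair a b)) (col-dyadic a b)

unpair₂-pair : ∀ a b → unpair₂ (pair a b) ≡ b
unpair₂-pair a b = trans (cong row (suc-pair a b)) (row-dyadic a b)

pair-unpair : ∀ u → pair (unpair₁ u) (unpair₂ u) ≡ u
pair-unpair u = cong (_∸ 1) (sym (col-row (suc u) z<s))

tripleN tripleX tripleL : ℕ → ℕ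
tripleN t = unpair₁ t
tripleX t = unpair₁ (unpair₂ t)
tripleL t = unpair₂ (unpair₂ t)

tripleN-triple : ∀ n x l → tripleN (triple n x l) ≡ n
tripleN-triple n x l = unpair₁-pair n (pair x l)

tripleX-triple : ∀ n x l → tripleX (triple n x l) ≡ x
tripleX-triple n x l = trans (cong unpair₁ (unpair₂-pair n (pair x l))) (unpair₁-pair x l)

triple-untriple : ∀ t → triple (tripleN t) (tripleX t) (tripleL t) ≡ t
triple-untriple t = trans (cong (pair (tripleN t)) (pair-unpair (unpair₂ t))) (pair-unpair t)

colE rowE unpair₁E unpair₂E : ∀ {k} → Expr k → Expr k
colE e = call colCode (unary col) (e ∷ [])
rowE e = call rowCode (unary row) (e ∷ [])
unpair₁E e = colE (lit 1 ⊕ e)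
unpair₂E e = rowE (lit 1 ⊕ e)

colE-wellCalled : ∀ {X k} (e : Expr k) → WellCalled X e → WellCalled X (colE e)
colE-wellCalled e w = colCode-computes , w , tt

unpair₁E-wellCalled : ∀ {X k} (e : Expr k) → WellCalled X e → WellCalled X (unpair₁E e)
unpair₁E-wellCalled e w = colCode-computes , (tt , w) , tt

unpair₂E-wellCalled : ∀ {X k} (e : Expr k) → WellCalled X e → WellCalled X (unpair₂E e)
unpair₂E-wellCalled e w = rowCode-computes , (tt , w) , tt

distance : ℕ → ℕ → ℕ
distance a b = (a ∸ b) + (b ∸ a)

distance≡0 : ∀ a b → distance a b ≡ 0 → a ≡ b
distance≡0 a b d≡0 =
  ≤-antisym (m∸n≡0⇒m≤n (m+n≡0⇒m≡0 (a ∸ b) d≡0)) (m∸n≡0⇒m≤n (m+n≡0⇒n≡0 (a ∸ b) d≡0))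

distanceE equalE : ∀ {k} → Expr k → Expr k → Expr k
distanceE a b = (a ⊖ b) ⊕ (b ⊖ a)
equalE a b = isZero (distanceE a b)

equal-value : ∀ a b → isz (distance a b) ≡ bit (a ≡ᵇ b)
equal-value zero zero = refl
equal-value zero (suc b) = refl
equal-value (suc a) zero = refl
equal-value (suc a) (suc b) = equal-value a b

≡ᵇ-refl : ∀ m → (m ≡ᵇ m) ≡ true
≡ᵇ-refl zero = refl
≡ᵇ-refl (suc m) = ≡ᵇ-refl m

≡ᵇ-true : ∀ a b → (a ≡ᵇ b) ≡ true → a ≡ b
≡ᵇ-true a b a≡ᵇb = ≡ᵇ⇒≡ a b (subst T (sym a≡ᵇb) tt)

R-col : ∀ X m → R X m → X (col m) ≡ true
R-col X _ (a , j , Xa , refl) = subst (λ b → X b ≡ true) (sym (col-dyadic a j)) Xa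

charR : Real → ℕ → ℕ
charR X m = sgn m * bit (X (col m))

Answers : ℕ → (ℕ → Set) → ℕ → Set
Answers v D m = (v ≡ 0 × ¬ D m) ⊎ (v ≡ 1 × D m)

charR-correct : ∀ X m → Answers (charR X m) (R X) m
charR-correct X zero = inj₁ (refl , λ (a , j , _ , 0≡) → <-irrefl 0≡ (dyadic-positive a j))
charR-correct X (suc m) rewrite +-identityʳ (bit (X (col (suc m)))) with X (col (suc m)) in Xa
... | true = inj₂ (refl , col (suc m) , row (suc m) , Xa , col-row (suc m) z<s)
... | false = inj₁ (refl , λ r → false≢true (trans (sym Xa) (R-col X (suc m) r)))
  where
  false≢true : false ≢ true
  false≢true ()

answer-on-column : ∀ X a j v → Answers v (R X) (dyadic a j) → v ≡ bit (X a)
answer-on-column X a j v answer with X a in Xa | answer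
... | true | inj₁ (_ , ∉R) = ⊥-elim (∉R (a , j , Xa , refl))
... | true | inj₂ (v≡1 , _) = v≡1
... | false | inj₁ (v≡0 , _) = v≡0
... | false | inj₂ (_ , ∈R) with trans (sym Xa) (subst (λ b → X b ≡ true) (col-dyadic a j) (R-col X _ ∈R))
...   | ()

totalOracle : Real → Real
totalOracle Y t = tripleX t ≡ᵇ charR Y (tripleN t)

totalOracle-triple : ∀ Y n x l → totalOracle Y (triple n x l) ≡ (x ≡ᵇ charR Y n)
totalOracle-triple Y n x l = cong₂ (λ x′ n′ → x′ ≡ᵇ charR Y n′) (tripleX-triple n x l) (tripleN-triple n x l)

totalOracle-generic : ∀ Y → GenericOracle (R Y) (totalOracle Y)
totalOracle-generic Y = (is-triple , says-0 , says-1) , everywhere-density1 _ in-domain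
  where
  charR≤1 : ∀ n → charR Y n ≤ 1
  charR≤1 n with charR-correct Y n
  ... | inj₁ (≡0 , _) = subst (_≤ 1) (sym ≡0) z≤n
  ... | inj₂ (≡1 , _) = subst (_≤ 1) (sym ≡1) ≤-refl
  says : ∀ n x l → totalOracle Y (triple n x l) ≡ true → x ≡ charR Y n
  says n x l entry = ≡ᵇ-true x _ (trans (sym (totalOracle-triple Y n x l)) entry)
  is-triple : ∀ t → totalOracle Y t ≡ true → ∃[ n ] ∃[ x ] ∃[ l ] (t ≡ triple n x l × x ≤ 1)
  is-triple t t∈O = tripleN t , tripleX t , tripleL t , sym (triple-untriple t) ,
                    subst (_≤ 1) (sym (≡ᵇ-true _ _ t∈O)) (charR≤1 (tripleN t))
  says-0 : ∀ n l → totalOracle Y (triple n 0 l) ≡ true → ¬ R Y n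
  says-0 n l entry with charR-correct Y n | says n 0 l entry
  ... | inj₁ (_ , ∉R) | _ = ∉R
  ... | inj₂ (≡1 , _) | 0≡ = ⊥-elim (0≢1+n (trans 0≡ ≡1))
  says-1 : ∀ n l → totalOracle Y (triple n 1 l) ≡ true → R Y n
  says-1 n l entry with charR-correct Y n | says n 1 l entry
  ... | inj₁ (≡0 , _) | 1≡ = ⊥-elim (0≢1+n (sym (trans 1≡ ≡0)))
  ... | inj₂ (_ , ∈R) | _ = ∈R
  in-domain : ∀ n → dom (totalOracle Y) n
  in-domain n = charR Y n , 0 , trans (totalOracle-triple Y n (charR Y n) 0) (≡ᵇ-refl (charR Y n))

tripleNE tripleXE : ∀ {k} → Expr k → Expr k
tripleNE t = unpair₁E t
tripleXE t = unpair₁E (unpair₂E t)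

oracleExpr : Expr 1
oracleExpr = equalE (tripleXE (var zero)) (sg (tripleNE (var zero)) ⊗ query (colE (tripleNE (var zero))))

oracleCode : Code 1
oracleCode = compile oracleExpr

oracleCode-computes : ∀ Y t → Eval Y oracleCode (t ∷ []) (bit (totalOracle Y t))
oracleCode-computes Y t =
  subst (Eval Y oracleCode (t ∷ [])) (equal-value (tripleX t) (charR Y (tripleN t)))
        (compile-computes oracleExpr wellCalled (t ∷ []))
  where
  t′ : Expr 1
  t′ = var zero
  tripleN-wellCalled : WellCalled Y (tripleNE t′)
  tripleN-wellCalled = unpair₁E-wellCalled t′ tt
  tripleX-wellCalled : WellCalled Y (tripleXE t′)
  tripleX-wellCalled = unpair₁E-wellCalled (unpair₂E t′) (unpair₂E-wellCalled t′ tt)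
  answer-wellCalled : WellCalled Y (sg (tripleNE t′) ⊗ query (colE (tripleNE t′)))
  answer-wellCalled = tripleN-wellCalled , colE-wellCalled (tripleNE t′) tripleN-wellCalled
  wellCalled : WellCalled Y oracleExpr
  wellCalled = (tripleX-wellCalled , answer-wellCalled) , (answer-wellCalled , tripleX-wellCalled)

-- (⇐) A generic reduction of R(X) to R(Y) yields a Turing reduction of X to Y

module FromGenericReduction (X Y : Real) (φ : Code 1)
                            (φ-generic : GenericComputation φ (totalOracle Y) (R X)) where
  open Clocked Y
  open Relativization (oracleCode-computes Y)

  φY : Code 1
  φY = relativize φ oracleCode

  -- A probe u stands for the point j = unpair₁ u of a column and the step
  -- budget s = unpair₂ u; probe a u is the clocked run of φY at dyadic a j.
  probe : ℕ → ℕ → ℕ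
  probe a u = clocked φY (unpair₂ u) (dyadic a (unpair₁ u) ∷ [])

  probeE : ∀ {k} → Expr k → Expr k → Expr k
  probeE a u = call (clockCode φY) (clockedFn φY)
                    (unpair₂E u ∷ call pow2Code (unary (2 ^_)) (a ∷ []) ⊗ (lit 2 ⊗ unpair₁E u ⊕ lit 1)
                               ∷ [])

  probeE-wellCalled : ∀ {k} (a u : Expr k) → WellCalled Y a → WellCalled Y u → WellCalled Y (probeE a u)
  probeE-wellCalled a u wa wu =
    clockCode-computes φY , unpair₂E-wellCalled u wu ,
    ((pow2Code-computes , wa , tt) , (tt , unpair₁E-wellCalled u wu) , tt) , tt

  -- Every column contains a point where φ converges on the total oracle,
  -- so some probe in every column succeeds.
  successTest : Vec ℕ 2 → ℕ
  successTest (u ∷ a ∷ []) = isz (probe a u)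

  successful-probe : HasZeros successTest
  successful-probe (a ∷ []) with meets-every-column _ (proj₁ φ-generic) a
  ... | j , v , φ↓ = pair j s , cong isz (trans probe≡ (proj₂ runs s ≤-refl))
    where
    runs : Eventually (λ s → clocked φY s (dyadic a j ∷ []) ≡ suc v)
    runs = clocked-complete (relativize⁺ φ↓)
    s = proj₁ runs
    probe≡ : probe a (pair j s) ≡ clocked φY s (dyadic a j ∷ [])
    probe≡ = cong₂ (λ j′ s′ → clocked φY s′ (dyadic a j′ ∷ [])) (unpair₁-pair j s) (unpair₂-pair j s)

  probe-sound : ∀ a u → isz (probe a u) ≡ 0 → pred (probe a u) ≡ bit (X a)
  probe-sound a u success with probe a u in run
  probe-sound a u () | zero
  ... | suc v = answer-on-column X a (unpair₁ u) v
                  (proj₂ φ-generic (dyadic a (unpair₁ u)) v (relativize⁻ φ (clocked-sound φY _ _ v run)))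

  successTestE : Expr 2
  successTestE = isZero (probeE (var (suc zero)) (var zero))

  successTestE-value : ∀ xs → ⟦ successTestE ⟧ Y xs ≡ successTest xs
  successTestE-value (u ∷ a ∷ []) = refl

  firstSuccessCode : Code 1
  firstSuccessCode = mu (compile successTestE)

  firstSuccess : Vec ℕ 1 → ℕ
  firstSuccess = search successTest successful-probe

  firstSuccessCode-computes : Computes Y firstSuccessCode firstSuccess
  firstSuccessCode-computes =
    search-computes successful-probe
      (computes-ext successTestE-value
                    (compile-computes successTestE (probeE-wellCalled {k = 2} (var (suc zero)) (var zero) tt tt)))

  firstSuccessE : Expr 1
  firstSuccessE = call firstSuccessCode firstSuccess (var zero ∷ [])

  reductionExpr : Expr 1
  reductionExpr = dec (probeE (var zero) firstSuccessE)

  reduction : Code 1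
  reduction = compile reductionExpr

  reduction-computes : ∀ a → Eval Y reduction (a ∷ []) (bit (X a))
  reduction-computes a =
    subst (Eval Y reduction (a ∷ []))
          (probe-sound a (firstSuccess (a ∷ [])) (search-zero successTest successful-probe (a ∷ [])))
          (compile-computes reductionExpr
                            (probeE-wellCalled (var zero) firstSuccessE tt (firstSuccessCode-computes , tt , tt))
                            (a ∷ []))

generic⇒Turing : ∀ X Y → R Y ≥g R X → Y ≥T X
generic⇒Turing X Y (φ , φ-reduces) = reduction , reduction-computes
  where open FromGenericReduction X Y φ (φ-reduces (totalOracle Y) (totalOracle-generic Y))

-- (⇒) A Turing reduction of X to Y yields a generic reduction of R(X) to R(Y)

partialOracle-correct : ∀ Y O → PartialOracle (R Y) O → ∀ n x l →
                        O (triple n x l) ≡ true → x ≤ 1 → x ≡ charR Y n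
partialOracle-correct Y O (_ , says-0 , says-1) n x l entry x≤1 with charR-correct Y n | x | x≤1
... | inj₁ (≡0 , _) | zero | _ = sym ≡0
... | inj₂ (_ , ∈R) | zero | _ = ⊥-elim (says-0 n l entry ∈R)
... | inj₁ (_ , ∉R) | suc zero | _ = ⊥-elim (∉R (says-1 n l entry))
... | inj₂ (≡1 , _) | suc zero | _ = sym ≡1
... | _ | suc (suc _) | s≤s ()

-- A witness for Y(b) in the oracle O is an entry ⟨n, x, l⟩ ∈ O with n in
-- column b; witnessTest O t b is 0 exactly for such entries t.
witnessTest : Real → ℕ → ℕ → ℕ
witnessTest O t b = isz (bit (O t)) + isz (tripleN t) + distance (col (tripleN t)) b

witnessTestE : Expr 2
witnessTestE = isZero (query (var zero)) ⊕ isZero (tripleNE (var zero))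
               ⊕ distanceE (colE (tripleNE (var zero))) (var (suc zero))

witnessTestE-computes : ∀ {O} → Computes O (compile witnessTestE) (binary (witnessTest O))
witnessTestE-computes {O} =
  computes-ext (λ { (t ∷ b ∷ []) → refl })
               (compile-computes witnessTestE ((tt , tripleN-w) , (col-w , tt) , (tt , col-w)))
  where
  tripleN-w : WellCalled O (tripleNE {2} (var zero))
  tripleN-w = unpair₁E-wellCalled {O} {2} (var zero) tt
  col-w : WellCalled O (colE (tripleNE {2} (var zero)))
  col-w = colE-wellCalled {O} {2} (tripleNE (var zero)) tripleN-w

-- Since dom O has density 1, column b contains the first component of some entry.
witness-exists : ∀ Y O → GenericOracle (R Y) O → ∀ b → ∃[ t ] witnessTest O t b ≡ 0
witness-exists Y O (_ , dense) b with meets-every-column _ dense b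
... | j , x , l , entry = triple (dyadic b j) x l , (begin
  isz (bit (O t)) + isz (tripleN t) + distance (col (tripleN t)) b
    ≡⟨ cong₂ (λ o n → isz (bit o) + isz n + distance (col n) b) entry (tripleN-triple (dyadic b j) x l) ⟩
  isz (dyadic b j) + distance (col (dyadic b j)) b
    ≡⟨ cong₂ (λ i c → i + distance c b) (isz-nonzero (m<n⇒n≢0 (dyadic-positive b j))) (col-dyadic b j) ⟩
  distance b b
    ≡⟨ cong₂ _+_ (n∸n≡0 b) (n∸n≡0 b) ⟩
  0 ∎)
  where
  open ≡-Reasoning
  t = triple (dyadic b j) x l

witnessTest≡0 : ∀ O t b → witnessTest O t b ≡ 0 → O t ≡ true × 0 < tripleN t × col (tripleN t) ≡ b
witnessTest≡0 O t b test≡0 =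
  in-O (O t) (m+n≡0⇒m≡0 _ first-two) , positive (tripleN t) (m+n≡0⇒n≡0 _ first-two) ,
  distance≡0 (col (tripleN t)) b (m+n≡0⇒n≡0 (isz (bit (O t)) + isz (tripleN t)) test≡0)
  where
  first-two = m+n≡0⇒m≡0 (isz (bit (O t)) + isz (tripleN t)) test≡0
  in-O : ∀ o → isz (bit o) ≡ 0 → o ≡ true
  in-O true _ = refl
  positive : ∀ n → isz n ≡ 0 → 0 < n
  positive (suc n) _ = z<s

witness-reveals : ∀ Y O → PartialOracle (R Y) O → ∀ t b → witnessTest O t b ≡ 0 → tripleX t ≡ bit (Y b)
witness-reveals Y O partial t b test≡0 with witnessTest≡0 O t b test≡0
... | t∈O , N-positive , col≡b with proj₁ partial t t∈O
...   | n , x , l , refl , x≤1 = begin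
  tripleX (triple n x l)        ≡⟨ tripleX-triple n x l ⟩
  x                             ≡⟨ partialOracle-correct Y O partial n x l t∈O x≤1 ⟩
  sgn n * bit (Y (col n))       ≡⟨ cong₂ (λ p c → p * bit (Y c)) (sgn-positive (subst (0 <_) N≡ N-positive))
                                         (trans (cong col (sym N≡)) col≡b) ⟩
  1 * bit (Y b)                 ≡⟨ +-identityʳ _ ⟩
  bit (Y b)                     ∎
  where
  open ≡-Reasoning
  N≡ = tripleN-triple n x l

-- Searching O for a witness and reading off its bit computes Y from every
-- generic oracle O for R(Y), with one code independent of O.
yCode : Code 1
yCode = comp (compile (tripleXE (var zero))) (mu (compile witnessTestE) ∷ [])

yCode-computes : ∀ Y O → GenericOracle (R Y) O → ∀ b → Eval O yCode (b ∷ []) (bit (Y b))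
yCode-computes Y O generic b =
  ecomp (search-computes has witnessTestE-computes (b ∷ []) ∷ [])
        (subst (Eval O (compile (tripleXE (var zero))) (t ∷ []))
               (witness-reveals Y O (proj₁ generic) t b (search-zero (binary (witnessTest O)) has (b ∷ [])))
               (compile-computes (tripleXE (var zero)) tripleX-w (t ∷ [])))
  where
  has : HasZeros (binary (witnessTest O))
  has (b ∷ []) = witness-exists Y O generic b
  t = search (binary (witnessTest O)) has (b ∷ [])
  tripleX-w : WellCalled O (tripleXE {1} (var zero))
  tripleX-w = unpair₁E-wellCalled {O} {1} (unpair₂E (var zero)) (unpair₂E-wellCalled {O} {1} (var zero) tt)

total⇒generic : ∀ {φ O D} (χ : ℕ → ℕ) → (∀ m → Answers (χ m) D m) →
                (∀ m → Eval O φ (m ∷ []) (χ m)) → GenericComputation φ O D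
total⇒generic {D = D} χ correct computes =
  everywhere-density1 _ (λ m → χ m , computes m) ,
  λ m v run → subst (λ w → Answers w D m) (eval-deterministic (computes m) run) (correct m)

-- R(X)(m) = sgn m · X(col m), with X computed by φ from Y, which in turn is
-- computed from the oracle.
genericReduction : Code 1 → Code 1
genericReduction φ = comp mulCode (sgCode ∷ comp (relativize φ yCode) (colCode ∷ []) ∷ [])

genericReduction-computes : ∀ X Y O φ → (∀ a → Eval Y φ (a ∷ []) (bit (X a))) →
                            GenericOracle (R Y) O →
                            ∀ m → Eval O (genericReduction φ) (m ∷ []) (charR X m)
genericReduction-computes X Y O φ φ-computes generic m =
  ecomp (sgCode-computes m ∷ ecomp (colCode-computes (m ∷ []) ∷ []) (relativize⁺ (φ-computes (col m)))
                          ∷ [])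
        (mulCode-computes _ _)
  where open Relativization (yCode-computes Y O generic)

Turing⇒generic : ∀ X Y → Y ≥T X → R Y ≥g R X
Turing⇒generic X Y (φ , φ-computes) =
  genericReduction φ , λ O generic →
    total⇒generic (charR X) (charR-correct X) (genericReduction-computes X Y O φ φ-computes generic)

mainTheorem8 : (X Y : Real) → (Y ≥T X) ⇔ (R Y ≥g R X)
mainTheorem8 X Y = mk⇔ (Turing⇒generic X Y) (generic⇒Turing X Y)
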